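{- If a finite algebra $\mathfrak{A}$ has almost minimal spectrum, then $\{\mathfrak{A}\}$ is a direct factor set.
   Context: A finite algebra $\mathfrak{A}$ has almost minimal spectrum iff every subalgebra of every finite power $\mathfrak{A}^n$ has cardinality a power of $|A|$. A subdirect product $\mathfrak{B}$ of $\mathfrak{A}_1,\dots,\mathfrak{A}_n$ is irreducible iff for every proper subset of the coordinate projections, the intersection of their kernels on $\mathfrak{B}$ is strictly larger than the identity congruence. A set $\mathcal{A}$ of finite algebras is a direct factor set iff whenever $\mathfrak{B}$ is an irreducible subdirect product of algebras $\mathfrak{A}_1,\dots,\mathfrak{A}_n$ from $\mathcal{A}$, then $\mathfrak{B}=\mathfrak{A}_1\times\dots\times\mathfrak{A}_n$. -}

module Defs where

open import Data.Nat using (ℕ; _^_; _≤_)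
open import Data.Fin using (Fin)
open import Data.Fin.Subset using (Subset; _∈_; _∉_)
open import Data.Vec using (Vec; lookup; tabulate)
open import Data.Bool using (Bool; T)
open import Data.Product using (Σ; ∃; ∃-syntax; _×_)
open import Function.Bundles using (_↔_)
open import Relation.Binary.PropositionalEquality using (_≡_)
open import Relation.Nullary using (¬_)

record Signature : Set₁ where
  field
    Op    : Set
    arity : Op → ℕ
open Signature public

-- A finite algebra of the given signature, with universe Fin m
-- (every finite algebra is isomorphic to one of this form).
record FinAlgebra (σ : Signature) : Set where
  field
    size     : ℕ
    nonempty : 1 ≤ size
    op       : (f : Op σ) → (Fin (arity σ f) → Fin size) → Fin size
open FinAlgebra public

Pow : ∀ {σ} → FinAlgebra σ → ℕ → Set
Pow 𝔄 n = Vec (Fin (size 𝔄)) n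

powOp : ∀ {σ} (𝔄 : FinAlgebra σ) (n : ℕ) (f : Op σ) →
        (Fin (arity σ f) → Pow 𝔄 n) → Pow 𝔄 n
powOp 𝔄 n f args = tabulate (λ j → op 𝔄 f (λ k → lookup (args k) j))

SubsetPow : ∀ {σ} → FinAlgebra σ → ℕ → Set
SubsetPow 𝔄 n = Pow 𝔄 n → Bool

IsSubalgebra : ∀ {σ} (𝔄 : FinAlgebra σ) (n : ℕ) → SubsetPow 𝔄 n → Set
IsSubalgebra {σ} 𝔄 n S =
  (∃[ v ] T (S v)) ×
  ((f : Op σ) (args : Fin (arity σ f) → Pow 𝔄 n) →
     (∀ k → T (S (args k))) → T (S (powOp 𝔄 n f args)))

HasCard : ∀ {σ} (𝔄 : FinAlgebra σ) (n : ℕ) → SubsetPow 𝔄 n → ℕ → Set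
HasCard 𝔄 n S k = (Σ (Pow 𝔄 n) (λ v → T (S v))) ↔ Fin k

AlmostMinimalSpectrum : ∀ {σ} → FinAlgebra σ → Set
AlmostMinimalSpectrum 𝔄 =
  ∀ (n : ℕ) (S : SubsetPow 𝔄 n) → IsSubalgebra 𝔄 n S →
    ∃[ j ] HasCard 𝔄 n S (size 𝔄 ^ j)

IsSubdirect : ∀ {σ} (𝔄 : FinAlgebra σ) (n : ℕ) → SubsetPow 𝔄 n → Set
IsSubdirect 𝔄 n S =
  IsSubalgebra 𝔄 n S ×
  (∀ (i : Fin n) (a : Fin (size 𝔄)) → ∃[ v ] (T (S v) × lookup v i ≡ a))

-- Irreducible: for every proper subset J of the coordinates, the
-- intersection of the kernels of the projections π_j (j ∈ J) restricted
-- to S is strictly larger than the identity, i.e. it relates two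
-- distinct elements of S.
IsIrreducible : ∀ {σ} (𝔄 : FinAlgebra σ) (n : ℕ) → SubsetPow 𝔄 n → Set
IsIrreducible 𝔄 n S =
  ∀ (J : Subset n) → (∃[ i ] i ∉ J) →
    ∃[ v ] ∃[ w ] (T (S v) × T (S w) × ¬ (v ≡ w) ×
                   (∀ j → j ∈ J → lookup v j ≡ lookup w j))

IsDirectFactorSingleton : ∀ {σ} → FinAlgebra σ → Set
IsDirectFactorSingleton 𝔄 =
  ∀ (n : ℕ) (S : SubsetPow 𝔄 n) → IsSubdirect 𝔄 n S → IsIrreducible 𝔄 n S →
    ∀ (v : Pow 𝔄 n) → T (S v)

{-# OPTIONS --safe #-}
-- If S ≤ 𝔄^(1+n) is an irreducible subdirect power, then so
-- is its projection onto the last n coordinates, which is therefore all of 𝔄ⁿ.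
-- Irreducibility also makes that projection non-injective on S, so
-- |A|ⁿ < |S| ≤ |A|^(1+n); since |S| is a power of |A|, it is |A|^(1+n), i.e. S = 𝔄^(1+n).
module Submission where

open import Defs
open import Data.Nat using (zero; suc; _^_; _≤_; _<_; NonZero; >-nonZero)
open import Data.Nat.Properties using (≤-antisym; ^-monoʳ-≤; <⇒≱; ≰⇒>; <-irrefl)
open import Data.Fin using (Fin; zero; suc; _≟_)
open import Data.Fin.Properties using (injective⇒≤; any?; 1↔⊤; +↔⊎; *↔×)
import Data.Fin.Subset as Subset
open import Data.Fin.Subset.Properties using (∈⊤)
open import Data.Vec using (Vec; []; _∷_; lookup; uncons; here; there)
open import Data.Vec.Properties using (∷-injective; ∷-injectiveʳ; tabulate∘lookup; tabulate-cong)
open import Data.Bool using (true; false; T)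
open import Data.Bool.Properties using (T?; T-irrelevant)
open import Data.Product using (Σ; ∃-syntax; _×_; _,_; proj₁; proj₂; uncurry)
open import Data.Product.Function.NonDependent.Propositional using (_×-↔_)
open import Data.Sum using (_⊎_; inj₁; inj₂; [_,_])
open import Data.Sum.Function.Propositional using (_⊎-↔_)
open import Data.Empty using (⊥-elim)
open import Data.Unit using (tt) renaming (⊤ to Unit)
open import Function using (const)
open import Function.Bundles using (_↔_; _↣_; Injection; mk↔ₛ′; mk↣)
open import Function.Definitions using (Injective)
open import Function.Construct.Composition using (_↣-∘_)
open import Function.Properties.Inverse using (↔-refl; ↔-sym; ↔-trans; ↔⇒↣)
open import Relation.Binary.PropositionalEquality using (_≡_; _≢_; refl; sym; trans; cong; cong₂; subst)
open import Relation.Nullary using (¬_; yes; no)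
open import Relation.Nullary.Decidable using (⌊_⌋; fromWitness; toWitness; decidable-stable)

↣⇒card≤ : ∀ {A B : Set} {a b} → A ↔ Fin a → B ↔ Fin b → A ↣ B → a ≤ b
↣⇒card≤ A↔Fin B↔Fin f =
  injective⇒≤ (Injection.injective (↔⇒↣ B↔Fin ↣-∘ (f ↣-∘ ↔⇒↣ (↔-sym A↔Fin))))

↣-missing⇒card< : ∀ {A B : Set} {a b} → A ↔ Fin a → B ↔ Fin b →
                  (f : A ↣ B) (y : B) → (∀ x → Injection.to f x ≢ y) → a < b
↣-missing⇒card< {A} {B} A↔Fin B↔Fin f y y∉f =
  ↣⇒card≤ (↔-trans (↔-sym 1↔⊤ ⊎-↔ A↔Fin) (↔-sym +↔⊎)) B↔Fin (mk↣ {to = extend} extend-injective)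
  where
  open Injection f using (to; injective)
  extend : Unit ⊎ A → B
  extend = [ const y , to ]
  extend-injective : Injective _≡_ _≡_ extend
  extend-injective {inj₁ tt} {inj₁ tt} _  = refl
  extend-injective {inj₁ tt} {inj₂ x}  eq = ⊥-elim (y∉f x (sym eq))
  extend-injective {inj₂ x}  {inj₁ tt} eq = ⊥-elim (y∉f x eq)
  extend-injective {inj₂ x}  {inj₂ x′} eq = cong inj₂ (injective eq)

Vec-Fin↔Fin-^ : ∀ {m} n → Vec (Fin m) n ↔ Fin (m ^ n)
Vec-Fin↔Fin-^ zero = mk↔ₛ′ (λ _ → zero) (λ _ → []) (λ { zero → refl }) (λ { [] → refl })
Vec-Fin↔Fin-^ (suc n) =
  ↔-trans uncons↔ (↔-trans (↔-refl ×-↔ Vec-Fin↔Fin-^ n) (↔-sym *↔×))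
  where
  uncons↔ : ∀ {A : Set} {n} → Vec A (suc n) ↔ (A × Vec A n)
  uncons↔ = mk↔ₛ′ uncons (uncurry _∷_) (λ _ → refl) (λ { (_ ∷ _) → refl })

m^n<m^k≤m^[1+n]⇒m^k≡m^[1+n] : ∀ m .{{_ : NonZero m}} {n k} →
                               m ^ n < m ^ k → m ^ k ≤ m ^ suc n → m ^ k ≡ m ^ suc n
m^n<m^k≤m^[1+n]⇒m^k≡m^[1+n] m {n} {k} m^n<m^k m^k≤m^[1+n] =
  ≤-antisym m^k≤m^[1+n] (^-monoʳ-≤ m n<k)
  where
  n<k : n < k
  n<k = ≰⇒> (λ k≤n → <⇒≱ m^n<m^k (^-monoʳ-≤ m k≤n))

module _ {σ} (𝔄 : FinAlgebra σ) where

  Members : ∀ {n} → SubsetPow 𝔄 n → Set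
  Members {n} S = Σ (Pow 𝔄 n) (λ v → T (S v))

  Members↣Pow : ∀ {n} (S : SubsetPow 𝔄 n) → Members S ↣ Pow 𝔄 n
  Members↣Pow S = mk↣ {to = proj₁} λ { {v , p} {.v , q} refl → cong (v ,_) (T-irrelevant p q) }

  card≤size^n : ∀ {n S k} → HasCard 𝔄 n S k → k ≤ size 𝔄 ^ n
  card≤size^n {n} {S} |S|≡k = ↣⇒card≤ |S|≡k (Vec-Fin↔Fin-^ n) (Members↣Pow S)

  nonmember⇒card<size^n : ∀ {n S k v} → HasCard 𝔄 n S k → ¬ T (S v) → k < size 𝔄 ^ n
  nonmember⇒card<size^n {n} {S} {v = v} |S|≡k v∉S =
    ↣-missing⇒card< |S|≡k (Vec-Fin↔Fin-^ n) (Members↣Pow S) v (λ { (_ , v∈S) refl → v∉S v∈S })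

  card≡size^n⇒full : ∀ {n S} → HasCard 𝔄 n S (size 𝔄 ^ n) → ∀ v → T (S v)
  card≡size^n⇒full {S = S} |S|≡size^n v =
    decidable-stable (T? (S v)) (λ v∉S → <-irrefl refl (nonmember⇒card<size^n |S|≡size^n v∉S))

  dropHead : ∀ {n} → SubsetPow 𝔄 (suc n) → SubsetPow 𝔄 n
  dropHead S b = ⌊ any? (λ a → T? (S (a ∷ b))) ⌋

  module _ {n} {S : SubsetPow 𝔄 (suc n)} where

    dropHead-intro : ∀ {a b} → T (S (a ∷ b)) → T (dropHead S b)
    dropHead-intro {a} a∷b∈S = fromWitness (a , a∷b∈S)

    dropHead-elim : ∀ {b} → T (dropHead S b) → ∃[ a ] T (S (a ∷ b))
    dropHead-elim = toWitness

    dropHead-subalgebra : IsSubalgebra 𝔄 (suc n) S → IsSubalgebra 𝔄 n (dropHead S)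
    dropHead-subalgebra ((a ∷ b , a∷b∈S) , closed) = (b , dropHead-intro a∷b∈S) , closed′
      where
      closed′ : ∀ f args → (∀ k → T (dropHead S (args k))) → T (dropHead S (powOp 𝔄 n f args))
      -- powOp 𝔄 (suc n) f (λ k → a k ∷ args k) computes to op 𝔄 f a ∷ powOp 𝔄 n f args.
      closed′ f args args∈ =
        dropHead-intro (closed f (λ k → proj₁ (lift k) ∷ args k) (λ k → proj₂ (lift k)))
        where
        lift : ∀ k → ∃[ a ] T (S (a ∷ args k))
        lift k = dropHead-elim (args∈ k)

    dropHead-subdirect : IsSubdirect 𝔄 (suc n) S → IsSubdirect 𝔄 n (dropHead S)
    dropHead-subdirect (sub , onto) = dropHead-subalgebra sub , onto′
      where
      onto′ : ∀ i a → ∃[ b ] (T (dropHead S b) × lookup b i ≡ a)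
      onto′ i a with onto (suc i) a
      ... | _ ∷ b , x∷b∈S , bᵢ≡a = b , dropHead-intro x∷b∈S , bᵢ≡a

    dropHead-irreducible : IsIrreducible 𝔄 (suc n) S → IsIrreducible 𝔄 n (dropHead S)
    dropHead-irreducible irr J (i , i∉J)
      with irr (true ∷ J) (suc i , λ { (there i∈J) → i∉J i∈J })
    ... | x ∷ b , y ∷ c , x∷b∈S , y∷c∈S , x∷b≢y∷c , agree =
      b , c , dropHead-intro x∷b∈S , dropHead-intro y∷c∈S ,
      (λ b≡c → x∷b≢y∷c (cong₂ _∷_ (agree zero here) b≡c)) ,
      (λ j j∈J → agree (suc j) (there j∈J))

    HasTwoPointFibre : Set
    HasTwoPointFibre = ∃[ b ] ∃[ x ] ∃[ y ] (x ≢ y × T (S (x ∷ b)) × T (S (y ∷ b)))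

    irreducible⇒twoPointFibre : IsIrreducible 𝔄 (suc n) S → HasTwoPointFibre
    irreducible⇒twoPointFibre irr with irr (false ∷ Subset.⊤) (zero , λ ())
    ... | x ∷ b , y ∷ c , x∷b∈S , y∷c∈S , x∷b≢y∷c , agree =
      b , x , y , (λ x≡y → x∷b≢y∷c (cong₂ _∷_ x≡y b≡c)) ,
      x∷b∈S , subst (λ d → T (S (y ∷ d))) (sym b≡c) y∷c∈S
      where
      b≡c : b ≡ c
      b≡c = trans (sym (tabulate∘lookup b))
                  (trans (tabulate-cong (λ j → agree (suc j) (there ∈⊤))) (tabulate∘lookup c))

    -- The section b ↦ section b ∷ b of the tail projection injects 𝔄ⁿ into S,
    -- and a second point of a fibre lies off its image.
    module _ {k} (|S|≡k : HasCard 𝔄 (suc n) S k) (full : ∀ b → T (dropHead S b)) where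

      private
        section : Pow 𝔄 n → Fin (size 𝔄)
        section b = proj₁ (dropHead-elim (full b))

        section↣ : Pow 𝔄 n ↣ Members S
        section↣ = mk↣ {to = λ b → section b ∷ b , proj₂ (dropHead-elim (full b))}
                       (λ eq → ∷-injectiveʳ (cong proj₁ eq))

        offSection⇒size^n<card : ∀ {z b} → T (S (z ∷ b)) → z ≢ section b → size 𝔄 ^ n < k
        offSection⇒size^n<card {z} {b} z∷b∈S z≢sb =
          ↣-missing⇒card< (Vec-Fin↔Fin-^ n) |S|≡k section↣ (z ∷ b , z∷b∈S) missed
          where
          missed : ∀ b′ → Injection.to section↣ b′ ≢ (z ∷ b , z∷b∈S)
          missed b′ eq with ∷-injective (cong proj₁ eq)
          ... | sb≡z , refl = z≢sb (sym sb≡z)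

      twoPointFibre⇒size^n<card : HasTwoPointFibre → size 𝔄 ^ n < k
      twoPointFibre⇒size^n<card (b , x , y , x≢y , x∷b∈S , y∷b∈S) with x ≟ section b
      ... | yes x≡sb = offSection⇒size^n<card y∷b∈S (λ y≡sb → x≢y (trans x≡sb (sym y≡sb)))
      ... | no x≢sb = offSection⇒size^n<card x∷b∈S x≢sb

theorem2p60 : ∀ {σ : Signature} (𝔄 : FinAlgebra σ) →
    AlmostMinimalSpectrum 𝔄 → IsDirectFactorSingleton 𝔄
theorem2p60 𝔄 ams = full
  where
  instance
    size-nonZero : NonZero (size 𝔄)
    size-nonZero = >-nonZero (nonempty 𝔄)

  full : IsDirectFactorSingleton 𝔄
  full zero S ((([] , []∈S) , _) , _) _ [] = []∈S
  full (suc n) S sd@(sub , _) irr with ams (suc n) S sub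
  ... | k , |S|≡size^k =
    card≡size^n⇒full 𝔄 (subst (HasCard 𝔄 (suc n) S) size^k≡size^[1+n] |S|≡size^k)
    where
    tailsFull : ∀ b → T (dropHead 𝔄 S b)
    tailsFull = full n (dropHead 𝔄 S) (dropHead-subdirect 𝔄 sd) (dropHead-irreducible 𝔄 irr)
    size^k≡size^[1+n] : size 𝔄 ^ k ≡ size 𝔄 ^ suc n
    size^k≡size^[1+n] = m^n<m^k≤m^[1+n]⇒m^k≡m^[1+n] (size 𝔄) {n} {k}
      (twoPointFibre⇒size^n<card 𝔄 |S|≡size^k tailsFull (irreducible⇒twoPointFibre 𝔄 irr))
      (card≤size^n 𝔄 |S|≡size^k)
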